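{- Let $r\ge2$ and let $n\ge4$ be even, and let $m_1,\dots,m_r\ge1$ be integers. Let $D$ be the distance matrix of the graph $C(n;m_1,\dots,m_r)$. Then $\det D=0$.
   Context: $C(n;m_1,\dots,m_r)$ is the undirected, unweighted graph consisting of a path $u_0-u_1-\cdots-u_n$ of length $n$ together with, for each $1\le j\le r$, a path $u_n-v_1^{(j)}-\cdots-v_{m_j}^{(j)}-u_0$ through $m_j$ new vertices; thus it consists of $r$ cycles of lengths $n+m_1+1,\dots,n+m_r+1$, any two of which intersect exactly in the common path. Its distance matrix is $[d(x,y)]$ with $d$ the usual graph (shortest path) distance. -}

module Defs where

open import Data.Nat using (ℕ; zero; suc; _≤_)
open import Data.Fin using (Fin; zero; suc; toℕ; fromℕ; punchIn)
open import Data.Sum using (_⊎_; inj₁; inj₂)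
open import Data.Product using (Σ; _×_; _,_)
open import Data.Integer using (ℤ; +_; -_; _+_; _*_; 0ℤ; 1ℤ)
open import Relation.Binary.PropositionalEquality using (_≡_)

sumFin : ∀ {N} → (Fin N → ℤ) → ℤ
sumFin {zero}  f = 0ℤ
sumFin {suc N} f = f zero + sumFin (λ i → f (suc i))

sign : ℕ → ℤ
sign zero          = 1ℤ
sign (suc zero)    = - 1ℤ
sign (suc (suc k)) = sign k

det : ∀ {N} → (Fin N → Fin N → ℤ) → ℤ
det {zero}  M = 1ℤ
det {suc N} M =
  sumFin (λ j → sign (toℕ j) * (M zero j * det (λ a b → M (suc a) (punchIn j b))))

-- The graph C(n; m_1, ..., m_r).
-- Vertices: u_i (i = 0..n) and v^(j)_k (j : Fin r, k = 1..m_j, stored as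
-- k : Fin (m j), i.e. index k-1).

data Vertex (n r : ℕ) (m : Fin r → ℕ) : Set where
  u : Fin (suc n) → Vertex n r m
  v : (j : Fin r) → Fin (m j) → Vertex n r m

-- Directed description of the edges (the graph is undirected; see Adj).
data Edge {n r : ℕ} {m : Fin r → ℕ} : Vertex n r m → Vertex n r m → Set where
  pathE  : (a b : Fin (suc n)) → toℕ b ≡ suc (toℕ a) → Edge (u a) (u b)
  startE : (j : Fin r) (k : Fin (m j)) → toℕ k ≡ 0 → Edge (u (fromℕ n)) (v j k)
  midE   : (j : Fin r) (k l : Fin (m j)) → toℕ l ≡ suc (toℕ k) → Edge (v j k) (v j l)
  endE   : (j : Fin r) (k : Fin (m j)) → suc (toℕ k) ≡ m j → Edge (v j k) (u zero)

Adj : ∀ {n r m} → Vertex n r m → Vertex n r m → Set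
Adj x y = Edge x y ⊎ Edge y x

data Walk {n r : ℕ} {m : Fin r → ℕ} : Vertex n r m → Vertex n r m → ℕ → Set where
  nil  : ∀ {x} → Walk x x 0
  cons : ∀ {x y z k} → Adj x y → Walk y z k → Walk x z (suc k)

IsDistance : ∀ {n r m} → (Vertex n r m → Vertex n r m → ℕ) → Set
IsDistance {n} {r} {m} D =
  ∀ (x y : Vertex n r m) → Walk x y (D x y) × (∀ k → Walk x y k → D x y ≤ k)

module Submission where

-- The path and the r branches are r + 1 "ears", each running from u_n to u_0. For the vertex q
-- splitting an ear as a + b with |a - b| ≤ 2, the distance from a vertex at position p of an ear
-- (at distance p̄ from u_0) is |p - a| on the same ear and min (p + a) (p̄ + b) on any other:
-- walks give the upper bound, and the formula, being 1-Lipschitz along every edge and 0 at q,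
-- gives the lower bound. If two ears have lengths 2x + c and 2y + c with c ∈ {1, 2}, this formula
-- makes the columns of the targets at positions x + c, x of the first ear and y, y + c of the
-- second satisfy col₁ + col₃ = col₂ + col₄, so the determinant vanishes. Because n is even,
-- such a pair exists: the path with a branch of even length (m_j odd), or else two branches of
-- odd length.

open import Defs

module Arithmetic where

  open import Data.Nat using (ℕ; zero; suc; _+_; _*_; _∸_; _≤_; _<_; _⊓_; ∣_-_∣; z≤n; s≤s)
  open import Data.Nat.Properties
  open import Data.Nat.Tactic.RingSolver using (solve-∀)
  open import Data.Product using (Σ-syntax; _×_; _,_; proj₁; proj₂; swap)
  open import Data.Sum using (_⊎_; inj₁; inj₂)
  import Data.Sum as Sum
  open import Relation.Binary.PropositionalEquality

  n<m⇒m∸n≡suc[m∸suc[n]] : ∀ {m n} → n < m → m ∸ n ≡ suc (m ∸ suc n)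
  n<m⇒m∸n≡suc[m∸suc[n]] {suc m} {zero}  _         = refl
  n<m⇒m∸n≡suc[m∸suc[n]] {suc m} {suc n} (s≤s n<m) = n<m⇒m∸n≡suc[m∸suc[n]] n<m

  Lipschitz : (ℕ → ℕ) → Set
  Lipschitz f = ∀ p → f (suc p) ≤ suc (f p) × f p ≤ suc (f (suc p))

  Lipschitz-+ : ∀ c → Lipschitz (_+ c)
  Lipschitz-+ c p = ≤-refl , ≤-trans (n≤1+n (p + c)) (n≤1+n (suc p + c))

  Lipschitz-∸ : ∀ L c → Lipschitz (λ p → L ∸ p + c)
  Lipschitz-∸ L c p = ≤-trans (+-monoˡ-≤ c (∸-monoʳ-≤ L (n≤1+n p))) (n≤1+n _)
                    , +-monoˡ-≤ c (L∸p≤1+L∸[1+p] L p)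
    where
    L∸p≤1+L∸[1+p] : ∀ L p → L ∸ p ≤ suc (L ∸ suc p)
    L∸p≤1+L∸[1+p] zero    p       = ≤-trans (≤-reflexive (0∸n≡0 p)) z≤n
    L∸p≤1+L∸[1+p] (suc L) zero    = ≤-refl
    L∸p≤1+L∸[1+p] (suc L) (suc p) = L∸p≤1+L∸[1+p] L p

  Lipschitz-step : ∀ {f} → Lipschitz f → ∀ {x y} p → x ≡ f p → y ≡ f (suc p) → x ≤ suc y × y ≤ suc x
  Lipschitz-step lip p refl refl = swap (lip p)

  Lipschitz-⊓ : ∀ {f g} → Lipschitz f → Lipschitz g → Lipschitz (λ p → f p ⊓ g p)
  Lipschitz-⊓ lip-f lip-g p = ⊓-mono-≤ (proj₁ (lip-f p)) (proj₁ (lip-g p))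
                            , ⊓-mono-≤ (proj₂ (lip-f p)) (proj₂ (lip-g p))

  Lipschitz-∣-∣ : ∀ a → Lipschitz (∣_- a ∣)
  Lipschitz-∣-∣ zero    p rewrite ∣-∣-identityʳ p = ≤-refl , ≤-trans (n≤1+n p) (n≤1+n (suc p))
  Lipschitz-∣-∣ (suc a) zero    = ≤-trans (n≤1+n a) (n≤1+n (suc a)) , ≤-refl
  Lipschitz-∣-∣ (suc a) (suc p) = Lipschitz-∣-∣ a p

  p+q≡a+b⇒∣p-a∣+[p+b]⊓[q+a]≡a+b : ∀ p q a b → p + q ≡ a + b → ∣ p - a ∣ + (p + b) ⊓ (q + a) ≡ a + b
  p+q≡a+b⇒∣p-a∣+[p+b]⊓[q+a]≡a+b p q a b p+q≡a+b with ≤-total p a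
  ... | inj₁ p≤a = begin
    ∣ p - a ∣ + (p + b) ⊓ (q + a) ≡⟨ cong₂ _+_ (m≤n⇒∣m-n∣≡n∸m p≤a) (m≤n⇒m⊓n≡m p+b≤q+a) ⟩
    a ∸ p + (p + b)               ≡⟨ +-assoc (a ∸ p) p b ⟨
    a ∸ p + p + b                 ≡⟨ cong (_+ b) (m∸n+n≡m p≤a) ⟩
    a + b                         ∎
    where
    open ≡-Reasoning
    b≤q : b ≤ q
    b≤q = +-cancelˡ-≤ p b q (≤-trans (+-monoˡ-≤ b p≤a) (≤-reflexive (sym p+q≡a+b)))
    p+b≤q+a : p + b ≤ q + a
    p+b≤q+a = ≤-trans (+-mono-≤ p≤a b≤q) (≤-reflexive (+-comm a q))
  ... | inj₂ a≤p = begin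
    ∣ p - a ∣ + (p + b) ⊓ (q + a) ≡⟨ cong₂ _+_ (m≤n⇒∣n-m∣≡n∸m a≤p) (m≥n⇒m⊓n≡n q+a≤p+b) ⟩
    p ∸ a + (q + a)               ≡⟨ cong (p ∸ a +_) (+-comm q a) ⟩
    p ∸ a + (a + q)               ≡⟨ +-assoc (p ∸ a) a q ⟨
    p ∸ a + a + q                 ≡⟨ cong (_+ q) (m∸n+n≡m a≤p) ⟩
    p + q                         ≡⟨ p+q≡a+b ⟩
    a + b                         ∎
    where
    open ≡-Reasoning
    q≤b : q ≤ b
    q≤b = +-cancelˡ-≤ a q b (≤-trans (+-monoˡ-≤ q a≤p) (≤-reflexive p+q≡a+b))
    q+a≤p+b : q + a ≤ p + b
    q+a≤p+b = ≤-trans (+-mono-≤ q≤b a≤p) (≤-reflexive (+-comm b p))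

  [p+y]⊓[q+[c+y]]≡p⊓[q+c]+y : ∀ p q c y → (p + y) ⊓ (q + (c + y)) ≡ p ⊓ (q + c) + y
  [p+y]⊓[q+[c+y]]≡p⊓[q+c]+y p q c y =
    trans (cong ((p + y) ⊓_) (sym (+-assoc q c y))) (sym (+-distribʳ-⊓ y p (q + c)))

  [p+[c+y]]⊓[q+y]≡[p+c]⊓q+y : ∀ p q c y → (p + (c + y)) ⊓ (q + y) ≡ (p + c) ⊓ q + y
  [p+[c+y]]⊓[q+y]≡[p+c]⊓q+y p q c y =
    trans (cong (_⊓ (q + y)) (sym (+-assoc p c y))) (sym (+-distribʳ-⊓ y (p + c) q))

  ∣p-[c+x]∣+p⊓[q+c]≡∣p-x∣+[p+c]⊓q : ∀ p q c x → p + q ≡ x + (c + x) →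
                                    ∣ p - c + x ∣ + p ⊓ (q + c) ≡ ∣ p - x ∣ + (p + c) ⊓ q
  ∣p-[c+x]∣+p⊓[q+c]≡∣p-x∣+[p+c]⊓q p q c x p+q≡len = +-cancelʳ-≡ x _ _ (begin
    ∣ p - c + x ∣ + p ⊓ (q + c) + x          ≡⟨ +-assoc ∣ p - c + x ∣ (p ⊓ (q + c)) x ⟩
    ∣ p - c + x ∣ + (p ⊓ (q + c) + x)        ≡⟨ cong (∣ p - c + x ∣ +_) ([p+y]⊓[q+[c+y]]≡p⊓[q+c]+y p q c x) ⟨
    ∣ p - c + x ∣ + (p + x) ⊓ (q + (c + x))  ≡⟨ p+q≡a+b⇒∣p-a∣+[p+b]⊓[q+a]≡a+b p q (c + x) x (trans p+q≡len (+-comm x (c + x))) ⟩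
    c + x + x                                ≡⟨ +-comm (c + x) x ⟩
    x + (c + x)                              ≡⟨ p+q≡a+b⇒∣p-a∣+[p+b]⊓[q+a]≡a+b p q x (c + x) p+q≡len ⟨
    ∣ p - x ∣ + (p + (c + x)) ⊓ (q + x)      ≡⟨ cong (∣ p - x ∣ +_) ([p+[c+y]]⊓[q+y]≡[p+c]⊓q+y p q c x) ⟩
    ∣ p - x ∣ + ((p + c) ⊓ q + x)            ≡⟨ +-assoc ∣ p - x ∣ ((p + c) ⊓ q) x ⟨
    ∣ p - x ∣ + (p + c) ⊓ q + x              ∎)
    where open ≡-Reasoning

  fourTargets-onFirst : ∀ p q c x y → p + q ≡ x + (c + x) →
                        ∣ p - c + x ∣ + (p + y) ⊓ (q + (c + y)) ≡ ∣ p - x ∣ + (p + (c + y)) ⊓ (q + y)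
  fourTargets-onFirst p q c x y p+q≡len = begin
    ∣ p - c + x ∣ + (p + y) ⊓ (q + (c + y))  ≡⟨ cong (∣ p - c + x ∣ +_) ([p+y]⊓[q+[c+y]]≡p⊓[q+c]+y p q c y) ⟩
    ∣ p - c + x ∣ + (p ⊓ (q + c) + y)        ≡⟨ +-assoc ∣ p - c + x ∣ (p ⊓ (q + c)) y ⟨
    ∣ p - c + x ∣ + p ⊓ (q + c) + y          ≡⟨ cong (_+ y) (∣p-[c+x]∣+p⊓[q+c]≡∣p-x∣+[p+c]⊓q p q c x p+q≡len) ⟩
    ∣ p - x ∣ + (p + c) ⊓ q + y              ≡⟨ +-assoc ∣ p - x ∣ ((p + c) ⊓ q) y ⟩
    ∣ p - x ∣ + ((p + c) ⊓ q + y)            ≡⟨ cong (∣ p - x ∣ +_) ([p+[c+y]]⊓[q+y]≡[p+c]⊓q+y p q c y) ⟨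
    ∣ p - x ∣ + (p + (c + y)) ⊓ (q + y)      ∎
    where open ≡-Reasoning

  fourTargets-onSecond : ∀ p q c x y → p + q ≡ y + (c + y) →
                         (p + (c + x)) ⊓ (q + x) + ∣ p - y ∣ ≡ (p + x) ⊓ (q + (c + x)) + ∣ p - c + y ∣
  fourTargets-onSecond p q c x y p+q≡len =
    trans (+-comm ((p + (c + x)) ⊓ (q + x)) ∣ p - y ∣)
          (trans (sym (fourTargets-onFirst p q c y x p+q≡len))
                 (+-comm ∣ p - c + y ∣ ((p + x) ⊓ (q + (c + x)))))

  fourTargets-elsewhere : ∀ p q c x y → (p + (c + x)) ⊓ (q + x) + (p + y) ⊓ (q + (c + y))
                                      ≡ (p + x) ⊓ (q + (c + x)) + (p + (c + y)) ⊓ (q + y)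
  fourTargets-elsewhere p q c x y = begin
    (p + (c + x)) ⊓ (q + x) + (p + y) ⊓ (q + (c + y))  ≡⟨ cong₂ _+_ ([p+[c+y]]⊓[q+y]≡[p+c]⊓q+y p q c x)
                                                                    ([p+y]⊓[q+[c+y]]≡p⊓[q+c]+y p q c y) ⟩
    ((p + c) ⊓ q + x) + (p ⊓ (q + c) + y)              ≡⟨ exchange ((p + c) ⊓ q) (p ⊓ (q + c)) x y ⟩
    (p ⊓ (q + c) + x) + ((p + c) ⊓ q + y)              ≡⟨ cong₂ _+_ ([p+y]⊓[q+[c+y]]≡p⊓[q+c]+y p q c x)
                                                                    ([p+[c+y]]⊓[q+y]≡[p+c]⊓q+y p q c y) ⟨
    (p + x) ⊓ (q + (c + x)) + (p + (c + y)) ⊓ (q + y)  ∎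
    where
    open ≡-Reasoning
    exchange : ∀ s t x y → s + x + (t + y) ≡ t + x + (s + y)
    exchange = solve-∀

  suc≡x+[1+x]⊎x+[2+x] : ∀ L → (Σ[ x ∈ ℕ ] suc L ≡ x + (1 + x)) ⊎ (Σ[ x ∈ ℕ ] suc L ≡ x + (2 + x))
  suc≡x+[1+x]⊎x+[2+x] zero          = inj₁ (0 , refl)
  suc≡x+[1+x]⊎x+[2+x] (suc zero)    = inj₂ (0 , refl)
  suc≡x+[1+x]⊎x+[2+x] (suc (suc L)) = Sum.map (grow 1) (grow 2) (suc≡x+[1+x]⊎x+[2+x] L)
    where
    grow : ∀ c → Σ[ x ∈ ℕ ] suc L ≡ x + (c + x) → Σ[ x ∈ ℕ ] suc (suc (suc L)) ≡ x + (c + x)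
    grow c (x , eq) = suc x , trans (cong (λ t → suc (suc t)) eq) (shift c x)
      where
      shift : ∀ c x → suc (suc (x + (c + x))) ≡ suc x + (c + suc x)
      shift = solve-∀

  4≤2*t⇒2*t≡x+[2+x] : ∀ t → 4 ≤ 2 * t → Σ[ x ∈ ℕ ] 1 ≤ x × 2 * t ≡ x + (2 + x)
  4≤2*t⇒2*t≡x+[2+x] (suc zero) (s≤s (s≤s ()))
  4≤2*t⇒2*t≡x+[2+x] (suc (suc t)) _ = suc t , s≤s z≤n , halve t
    where
    halve : ∀ t → 2 * suc (suc t) ≡ suc t + (2 + suc t)
    halve = solve-∀

module Determinant where

  open import Data.Empty using (⊥-elim)
  open import Data.Fin using (Fin; zero; suc; toℕ; punchIn; punchOut; inject₁; _≟_)
  open import Data.Fin.Properties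
    using (punchInᵢ≢i; punchIn-punchOut; punchIn-injective; toℕ-inject₁; toℕ-injective)
  open import Data.Integer using (ℤ; +_; -[1+_]; -_; _+_; _*_; 0ℤ; 1ℤ; -1ℤ)
  open import Data.Integer.Properties using (neg-involutive; neg-distrib-+; *-zeroʳ; pos-+)
  open import Data.Integer.Tactic.RingSolver using (solve-∀)
  open import Data.Nat as ℕ using (ℕ; zero; suc; s≤s)
  import Data.Nat.Properties as ℕ
  open import Data.Product using (Σ-syntax; _,_)
  open import Function using (_∘′_)
  open import Function.Bundles using (_↔_; Inverse)
  open import Relation.Binary.Definitions using (tri<; tri≈; tri>)
  open import Relation.Binary.PropositionalEquality
  open import Relation.Nullary using (yes; no)

  Matrix : ℕ → Set
  Matrix N = Fin N → Fin N → ℤ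

  i≡-i⇒i≡0 : ∀ i → i ≡ - i → i ≡ 0ℤ
  i≡-i⇒i≡0 (+ zero)    _  = refl
  i≡-i⇒i≡0 (+ suc n)   ()
  i≡-i⇒i≡0 -[1+ n ]    ()

  sign-suc : ∀ k → sign (suc k) ≡ - sign k
  sign-suc zero = refl
  sign-suc (suc k) = trans (sym (neg-involutive (sign k))) (cong -_ (sym (sign-suc k)))

  sumFin-cong : ∀ {N} {f g : Fin N → ℤ} → (∀ i → f i ≡ g i) → sumFin f ≡ sumFin g
  sumFin-cong {zero} _ = refl
  sumFin-cong {suc N} f≗g = cong₂ _+_ (f≗g zero) (sumFin-cong (λ i → f≗g (suc i)))

  sumFin-neg : ∀ {N} (f : Fin N → ℤ) → sumFin (λ i → - f i) ≡ - sumFin f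
  sumFin-neg {zero} f = refl
  sumFin-neg {suc N} f = trans (cong (λ x → - f zero + x) (sumFin-neg (λ i → f (suc i))))
                               (sym (neg-distrib-+ (f zero) _))

  sumFin-linear : ∀ {N} (c : ℤ) (f g : Fin N → ℤ) →
                  sumFin (λ i → c * f i + g i) ≡ c * sumFin f + sumFin g
  sumFin-linear {zero} c f g = sym (cong (_+ 0ℤ) (*-zeroʳ c))
  sumFin-linear {suc N} c f g =
    trans (cong (λ x → c * f zero + g zero + x) (sumFin-linear c (λ i → f (suc i)) (λ i → g (suc i))))
          (regroup c (f zero) (g zero) _ _)
    where
    regroup : ∀ c a b x y → c * a + b + (c * x + y) ≡ c * (a + x) + (b + y)
    regroup = solve-∀

  minor : ∀ {n} → Matrix (suc n) → Fin (suc n) → Matrix n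
  minor M j a b = M (suc a) (punchIn j b)

  expansionTerm : ∀ {n} → Matrix (suc n) → Fin (suc n) → ℤ
  expansionTerm M j = sign (toℕ j) * (M zero j * det (minor M j))

  det-cong : ∀ {N} {M M′ : Matrix N} → (∀ a b → M a b ≡ M′ a b) → det M ≡ det M′
  det-cong {zero} _ = refl
  det-cong {suc N} M≗M′ = sumFin-cong λ j →
    cong₂ (λ x y → sign (toℕ j) * (x * y)) (M≗M′ zero j) (det-cong (λ a b → M≗M′ (suc a) (punchIn j b)))

  adjacentSwap : ∀ {n} → Fin n → Fin (suc n) → Fin (suc n)
  adjacentSwap zero    zero          = suc zero
  adjacentSwap zero    (suc zero)    = zero
  adjacentSwap zero    (suc (suc b)) = suc (suc b)
  adjacentSwap (suc k) zero          = zero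
  adjacentSwap (suc k) (suc b)       = suc (adjacentSwap k b)

  adjacentSwap-inject₁ : ∀ {n} (k : Fin n) → adjacentSwap k (inject₁ k) ≡ suc k
  adjacentSwap-inject₁ zero    = refl
  adjacentSwap-inject₁ (suc k) = cong suc (adjacentSwap-inject₁ k)

  adjacentSwap-suc : ∀ {n} (k : Fin n) → adjacentSwap k (suc k) ≡ inject₁ k
  adjacentSwap-suc zero    = refl
  adjacentSwap-suc (suc k) = cong suc (adjacentSwap-suc k)

  adjacentSwap-other : ∀ {n} (k : Fin n) j → j ≢ inject₁ k → j ≢ suc k → adjacentSwap k j ≡ j
  adjacentSwap-other zero    zero          j≢k _    = ⊥-elim (j≢k refl)
  adjacentSwap-other zero    (suc zero)    _   j≢1+k = ⊥-elim (j≢1+k refl)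
  adjacentSwap-other zero    (suc (suc j)) _   _     = refl
  adjacentSwap-other (suc k) zero          _   _     = refl
  adjacentSwap-other (suc k) (suc j) j≢k j≢1+k =
    cong suc (adjacentSwap-other k j (j≢k ∘′ cong suc) (j≢1+k ∘′ cong suc))

  adjacentSwap-punchIn-inject₁ : ∀ {n} (k : Fin (suc n)) b →
                                 adjacentSwap k (punchIn (inject₁ k) b) ≡ punchIn (suc k) b
  adjacentSwap-punchIn-inject₁ zero zero = refl
  adjacentSwap-punchIn-inject₁ zero (suc b) = refl
  adjacentSwap-punchIn-inject₁ {suc n} (suc k) zero = refl
  adjacentSwap-punchIn-inject₁ {suc n} (suc k) (suc b) = cong suc (adjacentSwap-punchIn-inject₁ k b)

  adjacentSwap-punchIn-suc : ∀ {n} (k : Fin (suc n)) b →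
                             adjacentSwap k (punchIn (suc k) b) ≡ punchIn (inject₁ k) b
  adjacentSwap-punchIn-suc zero zero = refl
  adjacentSwap-punchIn-suc zero (suc b) = refl
  adjacentSwap-punchIn-suc {suc n} (suc k) zero = refl
  adjacentSwap-punchIn-suc {suc n} (suc k) (suc b) = cong suc (adjacentSwap-punchIn-suc k b)

  adjacentSwap-punchIn : ∀ {n} (k : Fin (suc n)) j → j ≢ inject₁ k → j ≢ suc k →
                         Σ[ k′ ∈ Fin n ] (∀ b → adjacentSwap k (punchIn j b) ≡ punchIn j (adjacentSwap k′ b))
  adjacentSwap-punchIn zero zero j≢k _ = ⊥-elim (j≢k refl)
  adjacentSwap-punchIn zero (suc zero) _ j≢1+k = ⊥-elim (j≢1+k refl)
  adjacentSwap-punchIn {suc n} zero (suc (suc j)) _ _ = zero , commute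
    where
    commute : ∀ b → adjacentSwap zero (punchIn (suc (suc j)) b) ≡ punchIn (suc (suc j)) (adjacentSwap zero b)
    commute zero = refl
    commute (suc zero) = refl
    commute (suc (suc b)) = refl
  adjacentSwap-punchIn {suc n} (suc k) zero _ _ = k , λ _ → refl
  adjacentSwap-punchIn {suc n} (suc k) (suc j) j≢k j≢1+k
    with k′ , commute ← adjacentSwap-punchIn k j (j≢k ∘′ cong suc) (j≢1+k ∘′ cong suc) = suc k′ , commute′
    where
    commute′ : ∀ b → adjacentSwap (suc k) (punchIn (suc j) b) ≡ punchIn (suc j) (adjacentSwap (suc k′) b)
    commute′ zero = refl
    commute′ (suc b) = cong suc (commute b)

  sumFin-adjacentSwap : ∀ {n} (k : Fin n) (f : Fin (suc n) → ℤ) → sumFin (λ j → f (adjacentSwap k j)) ≡ sumFin f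
  sumFin-adjacentSwap zero f = exchange (f (suc zero)) (f zero) _
    where
    exchange : ∀ a b c → a + (b + c) ≡ b + (a + c)
    exchange = solve-∀
  sumFin-adjacentSwap (suc k) f = cong (λ x → f zero + x) (sumFin-adjacentSwap k (λ i → f (suc i)))

  swapColumns : ∀ {n} → Matrix (suc n) → Fin n → Matrix (suc n)
  swapColumns M k a b = M a (adjacentSwap k b)

  det-swapColumns : ∀ {n} (M : Matrix (suc n)) (k : Fin n) → det (swapColumns M k) ≡ - det M
  det-swapColumns {suc n} M k = begin
    sumFin (expansionTerm (swapColumns M k))             ≡⟨ sumFin-cong term ⟩
    sumFin (λ j → - expansionTerm M (adjacentSwap k j))  ≡⟨ sumFin-neg (λ j → expansionTerm M (adjacentSwap k j)) ⟩
    - sumFin (λ j → expansionTerm M (adjacentSwap k j))  ≡⟨ cong -_ (sumFin-adjacentSwap k (expansionTerm M)) ⟩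
    - sumFin (expansionTerm M)                           ∎
    where
    open ≡-Reasoning
    negate-sign : ∀ s x y → s * (x * y) ≡ - (- s * (x * y))
    negate-sign = solve-∀
    pull-sign : ∀ s x y → - s * (x * y) ≡ - (s * (x * y))
    pull-sign = solve-∀
    term : ∀ j → expansionTerm (swapColumns M k) j ≡ - expansionTerm M (adjacentSwap k j)
    term j with j ≟ inject₁ k | j ≟ suc k
    ... | yes refl | _
      rewrite adjacentSwap-inject₁ k | toℕ-inject₁ k | sign-suc (toℕ k)
            | det-cong {M = minor (swapColumns M k) (inject₁ k)} (λ a b → cong (M (suc a)) (adjacentSwap-punchIn-inject₁ k b))
            = negate-sign (sign (toℕ k)) (M zero (suc k)) (det (minor M (suc k)))
    ... | no _ | yes refl
      rewrite adjacentSwap-suc k | toℕ-inject₁ k | sign-suc (toℕ k)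
            | det-cong {M = minor (swapColumns M k) (suc k)} (λ a b → cong (M (suc a)) (adjacentSwap-punchIn-suc k b))
            = pull-sign (sign (toℕ k)) (M zero (inject₁ k)) (det (minor M (inject₁ k)))
    ... | no j≢k | no j≢1+k with k′ , commute ← adjacentSwap-punchIn k j j≢k j≢1+k
      rewrite adjacentSwap-other k j j≢k j≢1+k
            | det-cong {M = minor (swapColumns M k) j} {M′ = swapColumns (minor M j) k′} (λ a b → cong (M (suc a)) (commute b))
            | det-swapColumns (minor M j) k′
            = pull-neg (sign (toℕ j)) (M zero j) (det (minor M j))
      where
      pull-neg : ∀ s x y → s * (x * - y) ≡ - (s * (x * y))
      pull-neg = solve-∀

  det-equalAdjacentColumns : ∀ {n} (M : Matrix (suc n)) (k : Fin n) →
                             (∀ a → M a (inject₁ k) ≡ M a (suc k)) → det M ≡ 0ℤ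
  det-equalAdjacentColumns M k same = i≡-i⇒i≡0 (det M) (trans (sym (det-cong swap-invisible)) (det-swapColumns M k))
    where
    swap-invisible : ∀ a b → swapColumns M k a b ≡ M a b
    swap-invisible a b with b ≟ inject₁ k | b ≟ suc k
    ... | yes refl | _        = trans (cong (M a) (adjacentSwap-inject₁ k)) (sym (same a))
    ... | no _     | yes refl = trans (cong (M a) (adjacentSwap-suc k)) (same a)
    ... | no b≢k   | no b≢1+k = cong (M a) (adjacentSwap-other k b b≢k b≢1+k)

  -- Column suc k is moved next to column i by d adjacent swaps.
  det-equalColumns-gap : ∀ {n} d (M : Matrix (suc n)) (i : Fin (suc n)) (k : Fin n) →
                         toℕ k ≡ toℕ i ℕ.+ d → (∀ a → M a i ≡ M a (suc k)) → det M ≡ 0ℤ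
  det-equalColumns-gap zero M i k k≡i same = det-equalAdjacentColumns M k (λ a → trans (cong (M a) i≡k) (same a))
    where
    i≡k : inject₁ k ≡ i
    i≡k = toℕ-injective (trans (toℕ-inject₁ k) (trans k≡i (ℕ.+-identityʳ (toℕ i))))
  det-equalColumns-gap (suc d) M i zero k≡i _ = ⊥-elim (ℕ.m+1+n≢0 (toℕ i) (sym k≡i))
  det-equalColumns-gap {suc n} (suc d) M i (suc k) k≡i same = begin
    det M                          ≡⟨ neg-involutive (det M) ⟨
    - - det M                      ≡⟨ cong -_ (det-swapColumns M (suc k)) ⟨
    - det (swapColumns M (suc k))  ≡⟨ cong -_ moved ⟩
    - 0ℤ                           ∎
    where
    open ≡-Reasoning
    i<1+k : toℕ i ℕ.< suc (toℕ k)
    i<1+k = ℕ.≤-trans (ℕ.m≤m+n (suc (toℕ i)) d) (ℕ.≤-reflexive (trans (sym (ℕ.+-suc (toℕ i) d)) (sym k≡i)))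
    i≢1+k : i ≢ suc (inject₁ k)
    i≢1+k refl = ℕ.<-irrefl (cong suc (toℕ-inject₁ k)) i<1+k
    i≢2+k : i ≢ suc (suc k)
    i≢2+k refl = ℕ.<-asym i<1+k (ℕ.n<1+n _)
    gap : toℕ (inject₁ k) ≡ toℕ i ℕ.+ d
    gap = ℕ.suc-injective (trans (cong suc (toℕ-inject₁ k)) (trans k≡i (ℕ.+-suc (toℕ i) d)))
    moved : det (swapColumns M (suc k)) ≡ 0ℤ
    moved = det-equalColumns-gap d (swapColumns M (suc k)) i (inject₁ k) gap λ a → begin
      M a (adjacentSwap (suc k) i)        ≡⟨ cong (M a) (adjacentSwap-other (suc k) i i≢1+k i≢2+k) ⟩
      M a i                               ≡⟨ same a ⟩
      M a (suc (suc k))                   ≡⟨ cong (M a) (adjacentSwap-inject₁ (suc k)) ⟨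
      M a (adjacentSwap (suc k) (suc (inject₁ k))) ∎

  det-equalColumns-< : ∀ {N} (M : Matrix N) (i j : Fin N) → toℕ i ℕ.< toℕ j →
                       (∀ a → M a i ≡ M a j) → det M ≡ 0ℤ
  det-equalColumns-< M i (suc k) (s≤s i≤k) = det-equalColumns-gap (toℕ k ℕ.∸ toℕ i) M i k (sym (ℕ.m+[n∸m]≡n i≤k))

  det-equalColumns : ∀ {N} (M : Matrix N) (i j : Fin N) → i ≢ j → (∀ a → M a i ≡ M a j) → det M ≡ 0ℤ
  det-equalColumns M i j i≢j same with ℕ.<-cmp (toℕ i) (toℕ j)
  ... | tri< i<j _ _ = det-equalColumns-< M i j i<j same
  ... | tri≈ _ i≡j _ = ⊥-elim (i≢j (toℕ-injective i≡j))
  ... | tri> _ _ j<i = det-equalColumns-< M j i j<i (λ a → sym (same a))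

  replaceColumn : ∀ {N} → Matrix N → Fin N → (Fin N → ℤ) → Matrix N
  replaceColumn M k f a b with b ≟ k
  ... | yes _ = f a
  ... | no _  = M a b

  replaceColumn-here : ∀ {N} (M : Matrix N) k f a → replaceColumn M k f a k ≡ f a
  replaceColumn-here M k f a with k ≟ k
  ... | yes _  = refl
  ... | no k≢k = ⊥-elim (k≢k refl)

  replaceColumn-there : ∀ {N} (M : Matrix N) k f a b → b ≢ k → replaceColumn M k f a b ≡ M a b
  replaceColumn-there M k f a b b≢k with b ≟ k
  ... | yes b≡k = ⊥-elim (b≢k b≡k)
  ... | no _    = refl

  replaceColumn-self : ∀ {N} (M : Matrix N) k a b → replaceColumn M k (λ a′ → M a′ k) a b ≡ M a b
  replaceColumn-self M k a b with b ≟ k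
  ... | yes refl = refl
  ... | no _     = refl

  replaceColumn-cong : ∀ {N} (M : Matrix N) k {f g : Fin N → ℤ} → (∀ a → f a ≡ g a) →
                       ∀ a b → replaceColumn M k f a b ≡ replaceColumn M k g a b
  replaceColumn-cong M k f≗g a b with b ≟ k
  ... | yes _ = f≗g a
  ... | no _  = refl

  minor-replaceColumn : ∀ {n} (M : Matrix (suc n)) j k (j≢k : j ≢ k) f a b →
                        minor (replaceColumn M k f) j a b ≡ replaceColumn (minor M j) (punchOut j≢k) (λ a′ → f (suc a′)) a b
  minor-replaceColumn M j k j≢k f a b with b ≟ punchOut j≢k
  ... | yes refl = trans (cong (replaceColumn M k f (suc a)) (punchIn-punchOut j≢k)) (replaceColumn-here M k f (suc a))
  ... | no b≢k   = replaceColumn-there M k f (suc a) (punchIn j b)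
                     (λ eq → b≢k (punchIn-injective j b (punchOut j≢k) (trans eq (sym (punchIn-punchOut j≢k)))))

  det-replaceColumn-linear : ∀ {N} (M : Matrix N) k c (f g : Fin N → ℤ) →
    det (replaceColumn M k (λ a → c * f a + g a)) ≡ c * det (replaceColumn M k f) + det (replaceColumn M k g)
  det-replaceColumn-linear {suc N} M k c f g =
    trans (sumFin-cong term) (sumFin-linear c (expansionTerm (replaceColumn M k f)) (expansionTerm (replaceColumn M k g)))
    where
    term : ∀ j → expansionTerm (replaceColumn M k (λ a → c * f a + g a)) j
               ≡ c * expansionTerm (replaceColumn M k f) j + expansionTerm (replaceColumn M k g) j
    term j with j ≟ k
    ... | yes refl
      rewrite det-cong {M = minor (replaceColumn M j (λ a → c * f a + g a)) j} {M′ = minor M j}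
                (λ a b → replaceColumn-there M j _ (suc a) (punchIn j b) (punchInᵢ≢i j b))
            | det-cong {M = minor (replaceColumn M j f) j} {M′ = minor M j}
                (λ a b → replaceColumn-there M j _ (suc a) (punchIn j b) (punchInᵢ≢i j b))
            | det-cong {M = minor (replaceColumn M j g) j} {M′ = minor M j}
                (λ a b → replaceColumn-there M j _ (suc a) (punchIn j b) (punchInᵢ≢i j b))
            = distribute (sign (toℕ j)) c (f zero) (g zero) (det (minor M j))
      where
      distribute : ∀ s c x y R → s * ((c * x + y) * R) ≡ c * (s * (x * R)) + s * (y * R)
      distribute = solve-∀
    ... | no j≢k
      rewrite det-cong (minor-replaceColumn M j k j≢k (λ a → c * f a + g a))
            | det-cong (minor-replaceColumn M j k j≢k f)
            | det-cong (minor-replaceColumn M j k j≢k g)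
            | det-replaceColumn-linear (minor M j) (punchOut j≢k) c (λ a → f (suc a)) (λ a → g (suc a))
            = distribute (sign (toℕ j)) c (M zero j)
                (det (replaceColumn (minor M j) (punchOut j≢k) (λ a → f (suc a))))
                (det (replaceColumn (minor M j) (punchOut j≢k) (λ a → g (suc a))))
      where
      distribute : ∀ s c x A B → s * (x * (c * A + B)) ≡ c * (s * (x * A)) + s * (x * B)
      distribute = solve-∀

  det-replaceColumn-copy : ∀ {N} (M : Matrix N) k j → j ≢ k → det (replaceColumn M k (λ a → M a j)) ≡ 0ℤ
  det-replaceColumn-copy M k j j≢k = det-equalColumns (replaceColumn M k (λ a → M a j)) k j (j≢k ∘′ sym)
    (λ a → trans (replaceColumn-here M k _ a) (sym (replaceColumn-there M k _ a j j≢k)))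

  det≡0-ifColumnRelation : ∀ {N} (M : Matrix N) (i j k l : Fin N) → j ≢ i → k ≢ i → l ≢ i →
                           (∀ a → M a i + M a k ≡ M a j + M a l) → det M ≡ 0ℤ
  det≡0-ifColumnRelation M i j k l j≢i k≢i l≢i relation = begin
    det M                                                    ≡⟨ det-cong (replaceColumn-self M i) ⟨
    det (replaceColumn M i (λ a → M a i))                    ≡⟨ det-cong (replaceColumn-cong M i combination) ⟩
    det (replaceColumn M i (λ a → 1ℤ * M a j + rest a))      ≡⟨ det-replaceColumn-linear M i 1ℤ (λ a → M a j) rest ⟩
    1ℤ * det (copy j) + det (replaceColumn M i rest)         ≡⟨ cong (λ t → 1ℤ * det (copy j) + t)
                                                                     (det-replaceColumn-linear M i -1ℤ (λ a → M a k) (λ a → M a l)) ⟩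
    1ℤ * det (copy j) + (-1ℤ * det (copy k) + det (copy l))  ≡⟨ cong₂ (λ s t → 1ℤ * s + t) (copy≡0 j j≢i)
                                                                     (cong₂ (λ s t → -1ℤ * s + t) (copy≡0 k k≢i) (copy≡0 l l≢i)) ⟩
    0ℤ                                                       ∎
    where
    open ≡-Reasoning
    copy : Fin _ → Matrix _
    copy x = replaceColumn M i (λ a → M a x)
    copy≡0 : ∀ x → x ≢ i → det (copy x) ≡ 0ℤ
    copy≡0 = det-replaceColumn-copy M i
    rest : Fin _ → ℤ
    rest a = -1ℤ * M a k + M a l
    isolate : ∀ x y z t → x + z ≡ y + t → x ≡ 1ℤ * y + (-1ℤ * z + t)
    isolate x y z t eq = begin
      x                      ≡⟨ cancel x z ⟩
      x + z + -1ℤ * z        ≡⟨ cong (_+ -1ℤ * z) eq ⟩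
      y + t + -1ℤ * z        ≡⟨ regroup y z t ⟩
      1ℤ * y + (-1ℤ * z + t) ∎
      where
      cancel : ∀ x z → x ≡ x + z + -1ℤ * z
      cancel = solve-∀
      regroup : ∀ y z t → y + t + -1ℤ * z ≡ 1ℤ * y + (-1ℤ * z + t)
      regroup = solve-∀
    combination : ∀ a → M a i ≡ 1ℤ * M a j + rest a
    combination a = isolate (M a i) (M a j) (M a k) (M a l) (relation a)

  det-distanceMatrix≡0 : ∀ {A : Set} {N} (e : Fin N ↔ A) (D : A → A → ℕ) (q₁ q₂ q₃ q₄ : A) →
                         q₂ ≢ q₁ → q₃ ≢ q₁ → q₄ ≢ q₁ → (∀ w → D w q₁ ℕ.+ D w q₃ ≡ D w q₂ ℕ.+ D w q₄) →
                         det (λ a b → + D (Inverse.to e a) (Inverse.to e b)) ≡ 0ℤ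
  det-distanceMatrix≡0 e D q₁ q₂ q₃ q₄ q₂≢q₁ q₃≢q₁ q₄≢q₁ relation =
    det≡0-ifColumnRelation M (from q₁) (from q₂) (from q₃) (from q₄)
      (from-≢ q₂≢q₁) (from-≢ q₃≢q₁) (from-≢ q₄≢q₁) λ a → begin
        M a (from q₁) + M a (from q₃)      ≡⟨ cong₂ _+_ (column a q₁) (column a q₃) ⟩
        + D (to a) q₁ + + D (to a) q₃      ≡⟨ pos-+ (D (to a) q₁) (D (to a) q₃) ⟨
        + (D (to a) q₁ ℕ.+ D (to a) q₃)    ≡⟨ cong +_ (relation (to a)) ⟩
        + (D (to a) q₂ ℕ.+ D (to a) q₄)    ≡⟨ pos-+ (D (to a) q₂) (D (to a) q₄) ⟩
        + D (to a) q₂ + + D (to a) q₄      ≡⟨ cong₂ _+_ (column a q₂) (column a q₄) ⟨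
        M a (from q₂) + M a (from q₄)      ∎
    where
    open ≡-Reasoning
    open Inverse e using (to; from; strictlyInverseˡ)
    M : Matrix _
    M a b = + D (to a) (to b)
    column : ∀ a q → M a (from q) ≡ + D (to a) q
    column a q = cong (λ t → + D (to a) t) (strictlyInverseˡ q)
    from-≢ : ∀ {q q′} → q ≢ q′ → from q ≢ from q′
    from-≢ {q} {q′} q≢q′ eq = q≢q′ (trans (sym (strictlyInverseˡ q)) (trans (cong to eq) (strictlyInverseˡ q′)))

open import Data.Nat using (ℕ; _≤_)
open import Data.Fin using (Fin)

module CycleGraph (n r : ℕ) (m : Fin r → ℕ) (2≤n : 2 ≤ n) (1≤m : ∀ j → 1 ≤ m j) where

  open import Data.Empty using (⊥-elim)
  open import Data.Fin using (zero; suc; toℕ; fromℕ; fromℕ<)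
  import Data.Fin as Fin
  open import Data.Fin.Properties using (toℕ<n; toℕ-fromℕ; fromℕ<-toℕ; toℕ-fromℕ<; toℕ-injective)
  import Data.Integer as ℤ
  open import Data.Nat using (zero; suc; _+_; _∸_; _<_; _⊓_; ∣_-_∣; _<?_; z≤n; s≤s; s≤s⁻¹)
  open import Data.Nat.Properties
  open import Data.Product using (_×_; _,_; proj₁; proj₂; swap)
  open import Data.Sum using (inj₁; inj₂)
  import Data.Sum as Sum
  open import Function using (_∘_)
  open import Function.Bundles using (_↔_; Inverse)
  open import Relation.Binary.PropositionalEquality
  open import Relation.Nullary using (Dec; yes; no)
  open Arithmetic
  open Determinant using (det-distanceMatrix≡0)

  V : Set
  V = Vertex n r m

  data Ear : Set where
    path   : Ear
    branch : Fin r → Ear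

  earLength : Ear → ℕ
  earLength path       = n
  earLength (branch j) = suc (m j)

  _≟ᴱ_ : (e e′ : Ear) → Dec (e ≡ e′)
  path     ≟ᴱ path      = yes refl
  path     ≟ᴱ branch _  = no λ ()
  branch _ ≟ᴱ path      = no λ ()
  branch j ≟ᴱ branch j′ with j Fin.≟ j′
  ... | yes refl = yes refl
  ... | no j≢j′  = no λ { refl → j≢j′ refl }

  clamp : (k i : ℕ) → Fin (suc k)
  clamp k       zero    = zero
  clamp zero    (suc i) = zero
  clamp (suc k) (suc i) = suc (clamp k i)

  toℕ-clamp : ∀ k i → i ≤ k → toℕ (clamp k i) ≡ i
  toℕ-clamp k       zero    _         = refl
  toℕ-clamp (suc k) (suc i) (s≤s i≤k) = cong suc (toℕ-clamp k i i≤k)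

  clamp-toℕ : ∀ k (i : Fin (suc k)) → clamp k (toℕ i) ≡ i
  clamp-toℕ k       zero    = refl
  clamp-toℕ (suc k) (suc i) = cong suc (clamp-toℕ k i)

  branchVertex : Fin r → ℕ → V
  branchVertex j zero = u (fromℕ n)
  branchVertex j (suc k) with k <? m j
  ... | yes k<m = v j (fromℕ< k<m)
  ... | no _    = u zero

  -- Every ear runs from u_n (position 0) to u_0 (position earLength e); beyond its end the
  -- position is clamped to u_0.
  vertexAt : Ear → ℕ → V
  vertexAt path       p = u (clamp n (n ∸ p))
  vertexAt (branch j) p = branchVertex j p

  earOf : V → Ear
  earOf (u _)   = path
  earOf (v j _) = branch j

  position : V → ℕ
  position (u i)   = n ∸ toℕ i
  position (v _ k) = suc (toℕ k)

  position≤earLength : ∀ w → position w ≤ earLength (earOf w)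
  position≤earLength (u i)   = m∸n≤m n (toℕ i)
  position≤earLength (v j k) = s≤s (<⇒≤ (toℕ<n k))

  branchVertex-inner : ∀ j k (k<m : k < m j) → branchVertex j (suc k) ≡ v j (fromℕ< k<m)
  branchVertex-inner j k k<m with k <? m j
  ... | yes _   = refl
  ... | no k≮m  = ⊥-elim (k≮m k<m)

  branchVertex-end : ∀ j → branchVertex j (suc (m j)) ≡ u zero
  branchVertex-end j with m j <? m j
  ... | yes m<m = ⊥-elim (<-irrefl refl m<m)
  ... | no _    = refl

  vertexAt-earOf-position : ∀ w → vertexAt (earOf w) (position w) ≡ w
  vertexAt-earOf-position (u i) =
    cong u (trans (cong (clamp n) (m∸[m∸n]≡n (s≤s⁻¹ (toℕ<n i)))) (clamp-toℕ n i))
  vertexAt-earOf-position (v j k) =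
    trans (branchVertex-inner j (toℕ k) (toℕ<n k)) (cong (v j) (fromℕ<-toℕ k (toℕ<n k)))

  position-start : position (u (fromℕ n)) ≡ 0
  position-start = trans (cong (n ∸_) (toℕ-fromℕ n)) (n∸n≡0 n)

  vertexAt-start : ∀ e → vertexAt e 0 ≡ u (fromℕ n)
  vertexAt-start path       = cong u (toℕ-injective (trans (toℕ-clamp n n ≤-refl) (sym (toℕ-fromℕ n))))
  vertexAt-start (branch j) = refl

  vertexAt-end : ∀ e → vertexAt e (earLength e) ≡ u zero
  vertexAt-end path       = cong u (cong (clamp n) (n∸n≡0 n))
  vertexAt-end (branch j) = branchVertex-end j

  vertexAt-adjacent : ∀ e p → suc p ≤ earLength e → Adj (vertexAt e p) (vertexAt e (suc p))
  vertexAt-adjacent path p p<n = inj₂ (pathE (clamp n (n ∸ suc p)) (clamp n (n ∸ p)) (begin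
    toℕ (clamp n (n ∸ p))             ≡⟨ toℕ-clamp n (n ∸ p) (m∸n≤m n p) ⟩
    n ∸ p                             ≡⟨ n<m⇒m∸n≡suc[m∸suc[n]] p<n ⟩
    suc (n ∸ suc p)                   ≡⟨ cong suc (toℕ-clamp n (n ∸ suc p) (m∸n≤m n (suc p))) ⟨
    suc (toℕ (clamp n (n ∸ suc p)))   ∎))
    where open ≡-Reasoning
  vertexAt-adjacent (branch j) zero _ rewrite branchVertex-inner j 0 (1≤m j) =
    inj₁ (startE j (fromℕ< (1≤m j)) (toℕ-fromℕ< (1≤m j)))
  vertexAt-adjacent (branch j) (suc k) (s≤s k<m) rewrite branchVertex-inner j k k<m with suc k <? m j
  ... | yes 1+k<m =
    inj₁ (midE j (fromℕ< k<m) (fromℕ< 1+k<m) (trans (toℕ-fromℕ< 1+k<m) (cong suc (sym (toℕ-fromℕ< k<m)))))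
  ... | no 1+k≮m  =
    inj₁ (endE j (fromℕ< k<m) (trans (cong suc (toℕ-fromℕ< k<m)) (≤-antisym k<m (≮⇒≥ 1+k≮m))))

  _++ʷ_ : ∀ {x y z : V} {k l} → Walk x y k → Walk y z l → Walk x z (k + l)
  nil      ++ʷ w′ = w′
  cons a w ++ʷ w′ = cons a (w ++ʷ w′)

  reverseʷ : ∀ {x y : V} {k} → Walk x y k → Walk y x k
  reverseʷ nil                = nil
  reverseʷ (cons {k = k} a w) =
    subst (Walk _ _) (+-comm k 1) (reverseʷ w ++ʷ cons (Sum.swap a) nil)

  castʷ : ∀ {x x′ y y′ : V} {k k′} → x ≡ x′ → y ≡ y′ → k ≡ k′ → Walk x y k → Walk x′ y′ k′
  castʷ refl refl refl w = w

  walkForward : ∀ e p d → p + d ≤ earLength e → Walk (vertexAt e p) (vertexAt e (p + d)) d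
  walkForward e p zero    _ = castʷ refl (cong (vertexAt e) (sym (+-identityʳ p))) refl nil
  walkForward e p (suc d) p+d<len =
    cons (vertexAt-adjacent e p (≤-trans (s≤s (m≤m+n p d)) p+1+d≤len))
         (castʷ refl (cong (vertexAt e) (sym (+-suc p d))) refl (walkForward e (suc p) d p+1+d≤len))
    where
    p+1+d≤len : suc p + d ≤ earLength e
    p+1+d≤len = ≤-trans (≤-reflexive (sym (+-suc p d))) p+d<len

  walkAlong : ∀ e {p q} → p ≤ earLength e → q ≤ earLength e → Walk (vertexAt e p) (vertexAt e q) ∣ p - q ∣
  walkAlong e {p} {q} p≤len q≤len with ≤-total p q
  ... | inj₁ p≤q = castʷ refl (cong (vertexAt e) (m+[n∸m]≡n p≤q)) (sym (m≤n⇒∣m-n∣≡n∸m p≤q))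
                     (walkForward e p (q ∸ p) (≤-trans (≤-reflexive (m+[n∸m]≡n p≤q)) q≤len))
  ... | inj₂ q≤p = castʷ refl refl (sym (m≤n⇒∣n-m∣≡n∸m q≤p)) (reverseʷ
                     (castʷ refl (cong (vertexAt e) (m+[n∸m]≡n q≤p)) refl
                       (walkForward e q (p ∸ q) (≤-trans (≤-reflexive (m+[n∸m]≡n q≤p)) p≤len))))

  EdgeLipschitz : (V → ℕ) → Set
  EdgeLipschitz g = ∀ {x y} → Edge x y → g x ≤ suc (g y) × g y ≤ suc (g x)

  EdgeLipschitz-walk : ∀ {g} → EdgeLipschitz g → ∀ {x y k} → Walk x y k → g x ≤ k + g y
  EdgeLipschitz-walk lip nil               = ≤-refl
  EdgeLipschitz-walk lip (cons (inj₁ e) w) = ≤-trans (proj₁ (lip e)) (s≤s (EdgeLipschitz-walk lip w))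
  EdgeLipschitz-walk lip (cons (inj₂ e) w) = ≤-trans (proj₂ (lip e)) (s≤s (EdgeLipschitz-walk lip w))

  module Glue (F : Ear → ℕ → ℕ) (lip : ∀ e → Lipschitz (F e))
              (start : ∀ j → F (branch j) 0 ≡ F path 0)
              (end : ∀ j → F (branch j) (suc (m j)) ≡ F path n) where

    glue : V → ℕ
    glue w = F (earOf w) (position w)

    glue-EdgeLipschitz : EdgeLipschitz glue
    glue-EdgeLipschitz (pathE a b b≡1+a) = swap (Lipschitz-step (lip path) (n ∸ toℕ b) refl (cong (F path) (begin
      n ∸ toℕ a              ≡⟨ n<m⇒m∸n≡suc[m∸suc[n]] (subst (_≤ n) b≡1+a (s≤s⁻¹ (toℕ<n b))) ⟩
      suc (n ∸ suc (toℕ a))  ≡⟨ cong (λ i → suc (n ∸ i)) b≡1+a ⟨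
      suc (n ∸ toℕ b)        ∎)))
      where open ≡-Reasoning
    glue-EdgeLipschitz (startE j k k≡0) =
      Lipschitz-step (lip (branch j)) 0 (trans (cong (F path) position-start) (sym (start j)))
                                        (cong (λ i → F (branch j) (suc i)) k≡0)
    glue-EdgeLipschitz (midE j k l l≡1+k) =
      Lipschitz-step (lip (branch j)) (suc (toℕ k)) refl (cong (λ i → F (branch j) (suc i)) l≡1+k)
    glue-EdgeLipschitz (endE j k 1+k≡m) =
      Lipschitz-step (lip (branch j)) (suc (toℕ k)) refl
                     (trans (sym (end j)) (cong (λ i → F (branch j) (suc i)) (sym 1+k≡m)))

    glue-vertexAt : ∀ e p → p ≤ earLength e → glue (vertexAt e p) ≡ F e p
    glue-vertexAt path p p≤n =
      cong (F path) (trans (cong (n ∸_) (toℕ-clamp n (n ∸ p) (m∸n≤m n p))) (m∸[m∸n]≡n p≤n))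
    glue-vertexAt (branch j) zero _ = trans (cong (F path) position-start) (sym (start j))
    glue-vertexAt (branch j) (suc k) (s≤s k≤m) with m≤n⇒m<n∨m≡n k≤m
    ... | inj₁ k<m  = trans (cong glue (branchVertex-inner j k k<m))
                            (cong (λ i → F (branch j) (suc i)) (toℕ-fromℕ< k<m))
    ... | inj₂ refl = trans (cong glue (branchVertex-end j)) (sym (end j))

  positiveDistance⇒≢ : ∀ {D : V → V → ℕ} → IsDistance D → ∀ {w w′} → 1 ≤ D w w′ → w ≢ w′
  positiveDistance⇒≢ {D} isDistance {w} 1≤D refl with () ← ≤-trans 1≤D (proj₂ (isDistance w w) 0 nil)

  2≤earLength : ∀ e → 2 ≤ earLength e
  2≤earLength path       = 2≤n
  2≤earLength (branch j) = s≤s (1≤m j)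

  -- Distance along the graph from position p of ear e to the point splitting ear e′ as a + b.
  targetFunction : Ear → ℕ → ℕ → Ear → ℕ → ℕ
  targetFunction e′ a b e p with e ≟ᴱ e′
  ... | yes _ = ∣ p - a ∣
  ... | no _  = (p + a) ⊓ (earLength e ∸ p + b)

  targetFunction-same : ∀ e′ a b p → targetFunction e′ a b e′ p ≡ ∣ p - a ∣
  targetFunction-same e′ a b p with e′ ≟ᴱ e′
  ... | yes _    = refl
  ... | no e′≢e′ = ⊥-elim (e′≢e′ refl)

  targetFunction-other : ∀ e′ a b {e} p → e ≢ e′ → targetFunction e′ a b e p ≡ (p + a) ⊓ (earLength e ∸ p + b)
  targetFunction-other e′ a b {e} p e≢e′ with e ≟ᴱ e′
  ... | yes e≡e′ = ⊥-elim (e≢e′ e≡e′)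
  ... | no _     = refl

  module Target (e′ : Ear) (a b : ℕ) (a+b≡len : a + b ≡ earLength e′) (a≤2+b : a ≤ 2 + b) (b≤2+a : b ≤ 2 + a) where

    F : Ear → ℕ → ℕ
    F = targetFunction e′ a b

    F-Lipschitz : ∀ e → Lipschitz (F e)
    F-Lipschitz e with e ≟ᴱ e′
    ... | yes _ = Lipschitz-∣-∣ a
    ... | no _  = Lipschitz-⊓ (Lipschitz-+ a) (Lipschitz-∸ (earLength e) b)

    F-start : ∀ e → F e 0 ≡ a
    F-start e with e ≟ᴱ e′
    ... | yes _ = refl
    ... | no _  = m≤n⇒m⊓n≡m (≤-trans a≤2+b (+-monoˡ-≤ b (2≤earLength e)))

    ∣len-a∣≡b : ∣ earLength e′ - a ∣ ≡ b
    ∣len-a∣≡b = trans (cong ∣_- a ∣ (sym a+b≡len)) (trans (∣-∣-comm (a + b) a) (∣m-m+n∣≡n a b))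

    F-end : ∀ e → F e (earLength e) ≡ b
    F-end e with e ≟ᴱ e′
    ... | yes refl = ∣len-a∣≡b
    ... | no _     = trans (cong (λ t → (earLength e + a) ⊓ (t + b)) (n∸n≡0 (earLength e)))
                           (m≥n⇒m⊓n≡n (≤-trans b≤2+a (+-monoˡ-≤ a (2≤earLength e))))

    open Glue F F-Lipschitz (λ j → trans (F-start (branch j)) (sym (F-start path)))
                            (λ j → trans (F-end (branch j)) (sym (F-end path)))
      public

    target : V
    target = vertexAt e′ a

    a≤len : a ≤ earLength e′
    a≤len = ≤-trans (m≤m+n a b) (≤-reflexive a+b≡len)

    module _ (D : V → V → ℕ) (isDistance : IsDistance D) where

      distance≡glue : ∀ w → D w target ≡ glue w
      distance≡glue w = ≤-antisym (upper (earOf w ≟ᴱ e′)) lower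
        where
        p = position w
        p≤len = position≤earLength w
        shortest : ∀ {k} → Walk w target k → D w target ≤ k
        shortest = proj₂ (isDistance w target) _
        fromW : ∀ {q} → q ≤ earLength (earOf w) → Walk w (vertexAt (earOf w) q) ∣ p - q ∣
        fromW q≤len = castʷ (vertexAt-earOf-position w) refl refl (walkAlong (earOf w) p≤len q≤len)
        lower : glue w ≤ D w target
        lower = ≤-trans (EdgeLipschitz-walk glue-EdgeLipschitz (proj₁ (isDistance w target)))
                        (≤-reflexive (trans (cong (D w target +_) glue-target) (+-identityʳ _)))
          where
          glue-target : glue target ≡ 0
          glue-target = trans (glue-vertexAt e′ a a≤len) (trans (targetFunction-same e′ a b a) (∣n-n∣≡0 a))
        upper : Dec (earOf w ≡ e′) → D w target ≤ glue w
        upper (yes refl) = subst (D w target ≤_) (sym (targetFunction-same e′ a b p)) (shortest (fromW a≤len))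
        upper (no e≢e′) = subst (D w target ≤_) (sym (targetFunction-other e′ a b p e≢e′)) (⊓-glb viaStart viaEnd)
          where
          viaStart : D w target ≤ p + a
          viaStart = shortest (castʷ refl refl (cong (_+ a) (∣-∣-identityʳ p))
            (fromW z≤n ++ʷ castʷ (trans (vertexAt-start e′) (sym (vertexAt-start (earOf w)))) refl refl
                                  (walkAlong e′ z≤n a≤len)))
          viaEnd : D w target ≤ earLength (earOf w) ∸ p + b
          viaEnd = shortest (castʷ refl refl (cong₂ _+_ (m≤n⇒∣m-n∣≡n∸m p≤len) ∣len-a∣≡b)
            (fromW ≤-refl ++ʷ castʷ (trans (vertexAt-end e′) (sym (vertexAt-end (earOf w)))) refl refl
                                  (walkAlong e′ ≤-refl a≤len)))

      distance-vertexAt : ∀ e p → p ≤ earLength e → D (vertexAt e p) target ≡ F e p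
      distance-vertexAt e p p≤len = trans (distance≡glue (vertexAt e p)) (glue-vertexAt e p p≤len)

  module FourTargets (D : V → V → ℕ) (isDistance : IsDistance D)
                     (e₁ e₂ : Ear) (e₁≢e₂ : e₁ ≢ e₂) (x y c : ℕ) (1≤c : 1 ≤ c) (c≤2 : c ≤ 2) (1≤x : 1 ≤ x)
                     (len₁ : earLength e₁ ≡ x + (c + x)) (len₂ : earLength e₂ ≡ y + (c + y)) where

    c+z≤2+z : ∀ z → c + z ≤ 2 + z
    c+z≤2+z z = +-monoˡ-≤ z c≤2

    z≤2+[c+z] : ∀ z → z ≤ 2 + (c + z)
    z≤2+[c+z] z = m≤n+m z (2 + c)

    module T₁ = Target e₁ (c + x) x (trans (+-comm (c + x) x) (sym len₁)) (c+z≤2+z x) (z≤2+[c+z] x)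
    module T₂ = Target e₁ x (c + x) (sym len₁) (z≤2+[c+z] x) (c+z≤2+z x)
    module T₃ = Target e₂ y (c + y) (sym len₂) (z≤2+[c+z] y) (c+z≤2+z y)
    module T₄ = Target e₂ (c + y) y (trans (+-comm (c + y) y) (sym len₂)) (c+z≤2+z y) (z≤2+[c+z] y)

    relation : ∀ e p → p ≤ earLength e → T₁.F e p + T₃.F e p ≡ T₂.F e p + T₄.F e p
    relation e p p≤len with e ≟ᴱ e₁ | e ≟ᴱ e₂
    ... | yes refl | yes refl = ⊥-elim (e₁≢e₂ refl)
    ... | yes refl | no _     = fourTargets-onFirst p (earLength e ∸ p) c x y (trans (m+[n∸m]≡n p≤len) len₁)
    ... | no _     | yes refl = fourTargets-onSecond p (earLength e ∸ p) c x y (trans (m+[n∸m]≡n p≤len) len₂)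
    ... | no _     | no _     = fourTargets-elsewhere p (earLength e ∸ p) c x y

    distance-relation : ∀ w → D w T₁.target + D w T₃.target ≡ D w T₂.target + D w T₄.target
    distance-relation w
      rewrite T₁.distance≡glue D isDistance w | T₂.distance≡glue D isDistance w
            | T₃.distance≡glue D isDistance w | T₄.distance≡glue D isDistance w
            = relation (earOf w) (position w) (position≤earLength w)

    T₁≢T₂ : T₁.target ≢ T₂.target
    T₁≢T₂ = positiveDistance⇒≢ isDistance (begin
      1                      ≤⟨ 1≤c ⟩
      c                      ≡⟨ m+n∸n≡m c x ⟨
      c + x ∸ x              ≤⟨ m∸n≤∣m-n∣ (c + x) x ⟩
      ∣ c + x - x ∣          ≡⟨ targetFunction-same e₁ x (c + x) (c + x) ⟨
      T₂.F e₁ (c + x)        ≡⟨ T₂.distance-vertexAt D isDistance e₁ (c + x) T₁.a≤len ⟨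
      D T₁.target T₂.target  ∎)
      where open ≤-Reasoning

    T₁≢T₃ : T₁.target ≢ T₃.target
    T₁≢T₃ = positiveDistance⇒≢ isDistance (begin
      1                                                 ≤⟨ 1≤c ⟩
      c                                                 ≤⟨ ⊓-glb (≤-trans (m≤m+n c x) (m≤m+n (c + x) y))
                                                                 (≤-trans (m≤m+n c y) (m≤n+m (c + y) (earLength e₁ ∸ (c + x)))) ⟩
      (c + x + y) ⊓ (earLength e₁ ∸ (c + x) + (c + y))  ≡⟨ targetFunction-other e₂ y (c + y) (c + x) e₁≢e₂ ⟨
      T₃.F e₁ (c + x)                                   ≡⟨ T₃.distance-vertexAt D isDistance e₁ (c + x) T₁.a≤len ⟨
      D T₁.target T₃.target                             ∎)
      where open ≤-Reasoning

    T₁≢T₄ : T₁.target ≢ T₄.target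
    T₁≢T₄ = positiveDistance⇒≢ isDistance (begin
      1                                                 ≤⟨ ⊓-glb (≤-trans 1≤c (≤-trans (m≤m+n c x) (m≤m+n (c + x) (c + y))))
                                                                 (≤-trans 1≤x (≤-trans (≤-reflexive (sym len₁∸[c+x]≡x))
                                                                                        (m≤m+n _ y))) ⟩
      (c + x + (c + y)) ⊓ (earLength e₁ ∸ (c + x) + y)  ≡⟨ targetFunction-other e₂ (c + y) y (c + x) e₁≢e₂ ⟨
      T₄.F e₁ (c + x)                                   ≡⟨ T₄.distance-vertexAt D isDistance e₁ (c + x) T₁.a≤len ⟨
      D T₁.target T₄.target                             ∎)
      where
      open ≤-Reasoning
      len₁∸[c+x]≡x : earLength e₁ ∸ (c + x) ≡ x
      len₁∸[c+x]≡x = trans (cong (_∸ (c + x)) len₁) (m+n∸n≡m x (c + x))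

    det≡0 : ∀ N (e : Fin N ↔ V) → det (λ a b → ℤ.+ D (Inverse.to e a) (Inverse.to e b)) ≡ ℤ.0ℤ
    det≡0 N e = det-distanceMatrix≡0 e D T₁.target T₂.target T₃.target T₄.target
                  (T₁≢T₂ ∘ sym) (T₁≢T₃ ∘ sym) (T₁≢T₄ ∘ sym) distance-relation

  det≡0 : ∀ x → 1 ≤ x → n ≡ x + (2 + x) → (j₀ j₁ : Fin r) → j₀ ≢ j₁ →
          (D : V → V → ℕ) → IsDistance D → ∀ N (e : Fin N ↔ V) →
          det (λ a b → ℤ.+ D (Inverse.to e a) (Inverse.to e b)) ≡ ℤ.0ℤ
  det≡0 x 1≤x n≡x+[2+x] j₀ j₁ j₀≢j₁ D isDistance
    with suc≡x+[1+x]⊎x+[2+x] (m j₀) | suc≡x+[1+x]⊎x+[2+x] (m j₁)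
  ... | inj₂ (y , len₀) | _ =
    FourTargets.det≡0 D isDistance path (branch j₀) (λ ()) x y 2 (s≤s z≤n) ≤-refl 1≤x n≡x+[2+x] len₀
  ... | _ | inj₂ (y , len₁) =
    FourTargets.det≡0 D isDistance path (branch j₁) (λ ()) x y 2 (s≤s z≤n) ≤-refl 1≤x n≡x+[2+x] len₁
  ... | inj₁ (x₀ , len₀) | inj₁ (x₁ , len₁) =
    FourTargets.det≡0 D isDistance (branch j₀) (branch j₁) (λ { refl → j₀≢j₁ refl }) x₀ x₁ 1 ≤-refl (s≤s z≤n)
      (1≤half (2≤earLength (branch j₀)) len₀) len₀ len₁
    where
    1≤half : ∀ {L h} → 2 ≤ L → L ≡ h + (1 + h) → 1 ≤ h
    1≤half {h = zero}  (s≤s ()) refl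
    1≤half {h = suc h} _        _    = s≤s z≤n

open import Data.Nat using (zero; suc; _*_; z≤n; s≤s)
open import Data.Nat.Properties using (≤-trans)
open import Data.Fin using (zero; suc)
open import Data.Product using (Σ; _,_)
open import Data.Integer using (ℤ; +_; 0ℤ)
open import Function.Bundles using (_↔_; Inverse)
open import Relation.Binary.PropositionalEquality using (_≡_; trans; subst)
open Arithmetic using (4≤2*t⇒2*t≡x+[2+x])

mainTheorem5 : (n r : ℕ) (m : Fin r → ℕ) →
    2 ≤ r → 4 ≤ n → Σ ℕ (λ t → n ≡ 2 * t) → (∀ j → 1 ≤ m j) →
    (D : Vertex n r m → Vertex n r m → ℕ) → IsDistance D →
    (N : ℕ) (e : Fin N ↔ Vertex n r m) →
    det (λ a b → + D (Inverse.to e a) (Inverse.to e b)) ≡ 0ℤ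
mainTheorem5 n zero          m ()       _   _           _   _ _          _ _
mainTheorem5 n (suc zero)    m (s≤s ()) _   _           _   _ _          _ _
mainTheorem5 n (suc (suc r)) m _        4≤n (t , n≡2*t) 1≤m D isDistance N e
  with x , 1≤x , 2*t≡x+[2+x] ← 4≤2*t⇒2*t≡x+[2+x] t (subst (4 ≤_) n≡2*t 4≤n) =
  CycleGraph.det≡0 n (suc (suc r)) m (≤-trans (s≤s (s≤s z≤n)) 4≤n) 1≤m
    x 1≤x (trans n≡2*t 2*t≡x+[2+x]) zero (suc zero) (λ ()) D isDistance N e
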